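{- Fix $t\ge 0$. If $X$ and $Y$ are $t$-covered subtrees of $\mathcal{T}$ each containing the root $r$, then $X\cup Y$ is also a $t$-covered subtree containing $r$.
   Context: Setting: rooted tree $\mathcal{T}$ with root $r$, node weights $\ell_v>0$ for $v\neq r$, $\ell_r=0$, $\ell(Z)=\sum_{v\in Z}\ell_v$; a set of requests at nodes, each request $\rho$ at node $v_\rho$ with a non-negative non-decreasing waiting cost function $\omega_\rho$ with $\omega_\rho(0)=0$ (all requests arrive at time $0$). For a node set $U$, $\omega(U,t)=\sum_{\rho:\,v_\rho\in U}\omega_\rho(t)$. A subtree is a connected node set; its root $r_Z$ is its node closest to $r$; $Z_x$ denotes the set of descendants of $x$ (including $x$) in $Z$. A subtree $Z$ is $t$-mature if $\omega(Z,t)\ge\ell(Z)$, and $t$-covered if $Z_x$ is $t$-mature for every $x\in Z$ with $x\neq r_Z$.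
   Formalization: The node weights $\ell_v$, the time $t$ and the waiting costs are rational, each waiting cost function $\omega_\rho$ being a map from the rationals to the rationals. -}

module Defs where

open import Data.Nat as ℕ using (ℕ; zero; suc)
open import Data.Fin using (Fin; _≟_)
open import Data.Fin.Subset using (Subset; _∈_; _∪_; Nonempty; inside; outside)
open import Data.Fin.Subset.Properties using (_∈?_)
open import Data.Vec using (tabulate)
open import Data.List using (List; []; _∷_; filter; map; foldr; upTo; allFin)
open import Data.Bool.ListAction using (any)
open import Data.Bool using (Bool; true; false; _∧_; if_then_else_)
open import Data.Rational using (ℚ; 0ℚ; _+_; _≤_; _<_)
open import Data.Product using (Σ; ∃; _×_; _,_)
open import Data.Sum using (_⊎_)
open import Relation.Binary.PropositionalEquality using (_≡_; _≢_)
open import Relation.Nullary using (¬_)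
open import Relation.Nullary.Decidable using (⌊_⌋)

iter : ∀ {A : Set} → (A → A) → ℕ → A → A
iter f zero    a = a
iter f (suc k) a = f (iter f k a)

record RootedTree (N : ℕ) : Set where
  field
    root        : Fin N
    parent      : Fin N → Fin N
    parent-root : parent root ≡ root
    reaches     : ∀ v → ∃ λ k → iter parent k v ≡ root

-- A request: a node and a waiting cost function on time (time = ℚ, t ≥ 0).
record Request (N : ℕ) : Set where
  field
    node     : Fin N
    cost     : ℚ → ℚ
    cost-0   : cost 0ℚ ≡ 0ℚ
    cost-nn  : ∀ s → 0ℚ ≤ s → 0ℚ ≤ cost s
    cost-mon : ∀ s s' → 0ℚ ≤ s → s ≤ s' → cost s ≤ cost s'

record Instance (N : ℕ) : Set where
  field
    tree     : RootedTree N
  open RootedTree tree public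
  field
    ℓ        : Fin N → ℚ
    ℓ-root   : ℓ root ≡ 0ℚ
    ℓ-pos    : ∀ v → v ≢ root → 0ℚ < ℓ v
    requests : List (Request N)

sumℚ : List ℚ → ℚ
sumℚ = foldr _+_ 0ℚ

module _ {N : ℕ} (I : Instance N) where
  open Instance I

  ℓ[_] : Subset N → ℚ
  ℓ[ Z ] = sumℚ (map ℓ (filter (λ v → v ∈? Z) (allFin N)))

  ω[_,_] : Subset N → ℚ → ℚ
  ω[ U , t ] = sumℚ (map (λ ρ → Request.cost ρ t)
                         (filter (λ ρ → Request.node ρ ∈? U) requests))

  Adj : Fin N → Fin N → Set
  Adj u v = (u ≢ root × parent u ≡ v) ⊎ (v ≢ root × parent v ≡ u)

  data PathIn (Z : Subset N) : Fin N → Fin N → Set where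
    here : ∀ {u} → u ∈ Z → PathIn Z u u
    step : ∀ {u w v} → u ∈ Z → Adj u w → PathIn Z w v → PathIn Z u v

  IsSubtree : Subset N → Set
  IsSubtree Z = Nonempty Z × (∀ u v → u ∈ Z → v ∈ Z → PathIn Z u v)

  Depth : Fin N → ℕ → Set
  Depth v k = iter parent k v ≡ root × (∀ j → j ℕ.< k → iter parent j v ≢ root)

  IsRootOf : Subset N → Fin N → Set
  IsRootOf Z z = z ∈ Z × (∀ z' k k' → z' ∈ Z → Depth z k → Depth z' k' → k ℕ.≤ k')

  -- x is an ancestor of (or equal to) v: x = parent^k v for some k.
  -- Decided by checking k ≤ N (enough, since paths to the root have < N steps).
  isAnc : Fin N → Fin N → Bool
  isAnc x v = any (λ k → ⌊ iter parent k v ≟ x ⌋) (upTo (suc N))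

  desc : Subset N → Fin N → Subset N
  desc Z x = tabulate (λ v → ⌊ v ∈? Z ⌋ ∧ isAnc x v)

  Mature : ℚ → Subset N → Set
  Mature t Z = ℓ[ Z ] ≤ ω[ Z , t ]

  Covered : ℚ → Subset N → Set
  Covered t Z = ∀ rZ → IsRootOf Z rZ → ∀ x → x ∈ Z → x ≢ rZ → Mature t (desc Z x)

-- Write (X ∪ Y)_x = X_x ⊎ (Y_x ∖ X).  A rooted subtree is closed under
-- ancestors, so both pieces are closed under descendants inside X resp. Y,
-- and avoid the root.  Such a set D splits off a whole mature subtree Y_y,
-- where y ∈ D is a node whose parent is not in D; the rest is again closed
-- under descendants, and by induction on |D| every such set is mature.
-- Maturity is additive over disjoint unions, so (X ∪ Y)_x is mature.
module Submission where

open import Defs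
open import Data.Nat using (ℕ)
open import Data.Fin.Subset using (Subset; _∈_; _∪_)
open import Data.Rational using (ℚ; 0ℚ; _≤_)
open import Data.Product using (_×_)

import Data.Nat as Nat
open Nat using (zero; suc; z≤n; s≤s; _<_; _∸_)
import Data.Nat.Properties as ℕₚ
open import Data.Nat.Induction using (<-rec; <-wellFounded)
open import Induction.WellFounded using (Acc; acc)
open import Data.Fin using (Fin; toℕ; _≟_)
open import Data.Fin.Properties using (pigeonhole; toℕ<n)
open import Data.Fin.Subset using (_─_; _∉_; _⊆_; Empty; ∣_∣; outside)
open import Data.Fin.Subset.Properties
  using (_∈?_; x∈p∪q⁺; x∈p∪q⁻; ⊆-antisym; nonempty?; x∈p∧x∉q⇒x∈p─q; p─q⊆p; x∈p∩q⁺; p∩q≢∅⇒∣p─q∣<∣p∣)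
open import Data.Vec using (_∷_; tabulate; here; there)
open import Data.Vec.Properties using (lookup∘tabulate; []=⇒lookup; lookup⇒[]=)
open import Data.List using (List; []; _∷_; filter; map; upTo; allFin)
open import Data.List.Properties using (filter-accept; filter-reject)
open import Data.List.Relation.Unary.Any using (satisfied)
open import Data.List.Relation.Unary.Any.Properties using (any⁺; any⁻)
open import Data.List.Membership.Propositional using (lose)
open import Data.List.Membership.Propositional.Properties using (∈-upTo⁺)
open import Data.Bool using (Bool; T)
open import Data.Bool.Properties using (T-≡; T-∧)
open import Data.Rational using (_+_)
import Data.Rational.Properties as ℚₚ
open import Algebra.Bundles using (CommutativeMonoid)
open import Algebra.Properties.CommutativeSemigroup
  (CommutativeMonoid.commutativeSemigroup ℚₚ.+-0-commutativeMonoid) using (x∙yz≈y∙xz)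
open import Data.Product using (∃; _,_; proj₁; proj₂)
open import Data.Sum using (_⊎_; inj₁; inj₂; [_,_])
open import Data.Empty using (⊥-elim)
open import Function using (id; _∘_; Equivalence)
open import Relation.Binary.PropositionalEquality
  using (_≡_; _≢_; refl; sym; trans; cong; cong₂; subst; subst₂; module ≡-Reasoning)
open import Relation.Nullary using (¬_; Dec; yes; no)
open import Relation.Nullary.Decidable using (toWitness; fromWitness)

private variable
  n : ℕ

module _ {A : Set} (f : A → A) where

  iter-suc : ∀ k a → iter f (suc k) a ≡ iter f k (f a)
  iter-suc zero    a = refl
  iter-suc (suc k) a = cong f (iter-suc k a)

  iter-+ : ∀ k m a → iter f (k Nat.+ m) a ≡ iter f k (iter f m a)
  iter-+ zero    m a = refl
  iter-+ (suc k) m a = cong f (iter-+ k m a)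

  iter-∸ : ∀ {k m} a → k Nat.≤ m → iter f m a ≡ iter f (m ∸ k) (iter f k a)
  iter-∸ {k} {m} a k≤m = begin
    iter f m a                         ≡⟨ cong (λ j → iter f j a) (sym (ℕₚ.m∸n+n≡m k≤m)) ⟩
    iter f (m ∸ k Nat.+ k) a           ≡⟨ iter-+ (m ∸ k) k a ⟩
    iter f (m ∸ k) (iter f k a)      ∎
    where open ≡-Reasoning

  iter-fixed : ∀ {a} → f a ≡ a → ∀ k → iter f k a ≡ a
  iter-fixed fa≡a zero    = refl
  iter-fixed fa≡a (suc k) = trans (cong f (iter-fixed fa≡a k)) fa≡a

  iter-exit : ∀ {P : A → Set} → (∀ a → Dec (P a)) → ∀ k {a} → P a → ¬ P (iter f k a) →
              ∃ λ b → P b × ¬ P (f b)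
  iter-exit P? zero    pa ¬p = ⊥-elim (¬p pa)
  iter-exit {P} P? (suc k) {a} pa ¬p with P? (f a)
  ... | no ¬pfa = a , pa , ¬pfa
  ... | yes pfa = iter-exit P? k pfa (¬p ∘ subst P (sym (iter-suc k a)))

-- The first n + 1 iterates of a self-map of Fin n already repeat, so every
-- later iterate equals one of them.
iter-bounded : (f : Fin n → Fin n) (a : Fin n) (k : ℕ) →
               ∃ λ j → j < suc n × iter f j a ≡ iter f k a
iter-bounded {n} f a with pigeonhole (ℕₚ.n<1+n n) (λ i → iter f (toℕ i) a)
... | i , j , i<j , cycle = <-rec Bounded shorten
  where
  open ≡-Reasoning
  Bounded : ℕ → Set
  Bounded k = ∃ λ m → m < suc n × iter f m a ≡ iter f k a

  skip-cycle : ∀ {k} → toℕ j Nat.≤ k → iter f k a ≡ iter f (k ∸ toℕ j Nat.+ toℕ i) a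
  skip-cycle {k} j≤k = begin
    iter f k a                                ≡⟨ iter-∸ f a j≤k ⟩
    iter f (k ∸ toℕ j) (iter f (toℕ j) a)     ≡⟨ cong (iter f (k ∸ toℕ j)) cycle ⟨
    iter f (k ∸ toℕ j) (iter f (toℕ i) a)     ≡⟨ iter-+ f (k ∸ toℕ j) (toℕ i) a ⟨
    iter f (k ∸ toℕ j Nat.+ toℕ i) a          ∎

  skip-cycle-< : ∀ {k} → toℕ j Nat.≤ k → k ∸ toℕ j Nat.+ toℕ i < k
  skip-cycle-< {k} j≤k =
    subst (k ∸ toℕ j Nat.+ toℕ i <_) (ℕₚ.m∸n+n≡m j≤k) (ℕₚ.+-monoʳ-< (k ∸ toℕ j) i<j)

  shorten : ∀ k → (∀ {m} → m < k → Bounded m) → Bounded k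
  shorten k shorter with k Nat.<? toℕ j
  ... | yes k<j = k , ℕₚ.<-trans k<j (toℕ<n j) , refl
  ... | no  k≮j with shorter (skip-cycle-< (ℕₚ.≮⇒≥ k≮j))
  ...   | m , m<1+n , e = m , m<1+n , trans e (sym (skip-cycle (ℕₚ.≮⇒≥ k≮j)))

minimal-witness : ∀ {P : ℕ → Set} → (∀ m → Dec (P m)) → ∃ P →
                  ∃ λ m → P m × (∀ j → j < m → ¬ P j)
minimal-witness P? _ with P? 0
... | yes p0 = 0 , p0 , λ _ ()
minimal-witness P? (zero  , pk) | no ¬p0 = ⊥-elim (¬p0 pk)
minimal-witness P? (suc k , pk) | no ¬p0 with minimal-witness (P? ∘ suc) (k , pk)
... | m , pm , below = suc m , pm , λ where
  zero    _         → ¬p0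
  (suc j) (s≤s j<m) → below j j<m

Disjoint : Subset n → Subset n → Set
Disjoint p q = ∀ {x} → x ∈ p → x ∉ q

x∈p─q⇒x∉q : ∀ {x : Fin n} {p q} → x ∈ p ─ q → x ∉ q
x∈p─q⇒x∉q {p = _ ∷ _} {outside ∷ _} here ()
x∈p─q⇒x∉q {p = _ ∷ _} {_ ∷ _} (there x∈p─q) (there x∈q) = x∈p─q⇒x∉q x∈p─q x∈q

disjoint-─ : (p q : Subset n) → Disjoint p (q ─ p)
disjoint-─ p q x∈p x∈q─p = x∈p─q⇒x∉q x∈q─p x∈p

⊆⇒≡∪─ : ∀ {p q : Subset n} → p ⊆ q → q ≡ p ∪ (q ─ p)
⊆⇒≡∪─ {p = p} {q} p⊆q = ⊆-antisym split ([ p⊆q , p─q⊆p q p ] ∘ x∈p∪q⁻ p (q ─ p))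
  where
  split : q ⊆ p ∪ (q ─ p)
  split {x} x∈q with x ∈? p
  ... | yes x∈p = x∈p∪q⁺ (inj₁ x∈p)
  ... | no  x∉p = x∈p∪q⁺ (inj₂ (x∈p∧x∉q⇒x∈p─q x∈q x∉p))

∈-tabulate⁻ : ∀ {f : Fin n → Bool} {x} → x ∈ tabulate f → T (f x)
∈-tabulate⁻ {f = f} {x} x∈ =
  Equivalence.from T-≡ (trans (sym (lookup∘tabulate f x)) ([]=⇒lookup x∈))

∈-tabulate⁺ : ∀ {f : Fin n → Bool} {x} → T (f x) → x ∈ tabulate f
∈-tabulate⁺ {f = f} {x} fx =
  lookup⇒[]= x (tabulate f) (trans (lookup∘tabulate f x) (Equivalence.to T-≡ fx))

-- ℓ[_] and ω[_,_] are both of the form  sumIn key h Z xs.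
module _ {A : Set} (key : A → Fin n) (h : A → ℚ) where

  sumIn : Subset n → List A → ℚ
  sumIn Z xs = sumℚ (map h (filter (λ a → key a ∈? Z) xs))

  sumIn-∷-∈ : ∀ {Z a} xs → key a ∈ Z → sumIn Z (a ∷ xs) ≡ h a + sumIn Z xs
  sumIn-∷-∈ {Z} xs a∈Z = cong (sumℚ ∘ map h) (filter-accept (λ a → key a ∈? Z) a∈Z)

  sumIn-∷-∉ : ∀ {Z a} xs → key a ∉ Z → sumIn Z (a ∷ xs) ≡ sumIn Z xs
  sumIn-∷-∉ {Z} xs a∉Z = cong (sumℚ ∘ map h) (filter-reject (λ a → key a ∈? Z) a∉Z)

  sumIn-empty : ∀ {Z} → Empty Z → ∀ xs → sumIn Z xs ≡ 0ℚ
  sumIn-empty Z-empty []       = refl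
  sumIn-empty Z-empty (a ∷ xs) =
    trans (sumIn-∷-∉ xs (λ a∈Z → Z-empty (_ , a∈Z))) (sumIn-empty Z-empty xs)

  sumIn-∪ : ∀ {P Q} → Disjoint P Q → ∀ xs → sumIn (P ∪ Q) xs ≡ sumIn P xs + sumIn Q xs
  sumIn-∪ disj [] = sym (ℚₚ.+-identityʳ 0ℚ)
  sumIn-∪ {P} {Q} disj (a ∷ xs) = by-cases (key a ∈? P) (key a ∈? Q)
    where
    open ≡-Reasoning
    SP = sumIn P xs
    SQ = sumIn Q xs
    by-cases : Dec (key a ∈ P) → Dec (key a ∈ Q) →
               sumIn (P ∪ Q) (a ∷ xs) ≡ sumIn P (a ∷ xs) + sumIn Q (a ∷ xs)
    by-cases (yes a∈P) (yes a∈Q) = ⊥-elim (disj a∈P a∈Q)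
    by-cases (yes a∈P) (no  a∉Q) = begin
      sumIn (P ∪ Q) (a ∷ xs)           ≡⟨ sumIn-∷-∈ xs (x∈p∪q⁺ (inj₁ a∈P)) ⟩
      h a + sumIn (P ∪ Q) xs           ≡⟨ cong (h a +_) (sumIn-∪ disj xs) ⟩
      h a + (SP + SQ)                  ≡⟨ ℚₚ.+-assoc (h a) SP SQ ⟨
      (h a + SP) + SQ                  ≡⟨ cong₂ _+_ (sumIn-∷-∈ xs a∈P) (sumIn-∷-∉ xs a∉Q) ⟨
      sumIn P (a ∷ xs) + sumIn Q (a ∷ xs) ∎
    by-cases (no  a∉P) (yes a∈Q) = begin
      sumIn (P ∪ Q) (a ∷ xs)           ≡⟨ sumIn-∷-∈ xs (x∈p∪q⁺ (inj₂ a∈Q)) ⟩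
      h a + sumIn (P ∪ Q) xs           ≡⟨ cong (h a +_) (sumIn-∪ disj xs) ⟩
      h a + (SP + SQ)                  ≡⟨ x∙yz≈y∙xz (h a) SP SQ ⟩
      SP + (h a + SQ)                  ≡⟨ cong₂ _+_ (sumIn-∷-∉ xs a∉P) (sumIn-∷-∈ xs a∈Q) ⟨
      sumIn P (a ∷ xs) + sumIn Q (a ∷ xs) ∎
    by-cases (no  a∉P) (no  a∉Q) = begin
      sumIn (P ∪ Q) (a ∷ xs)           ≡⟨ sumIn-∷-∉ xs ([ a∉P , a∉Q ] ∘ x∈p∪q⁻ P Q) ⟩
      sumIn (P ∪ Q) xs                 ≡⟨ sumIn-∪ disj xs ⟩
      SP + SQ                          ≡⟨ cong₂ _+_ (sumIn-∷-∉ xs a∉P) (sumIn-∷-∉ xs a∉Q) ⟨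
      sumIn P (a ∷ xs) + sumIn Q (a ∷ xs) ∎

module _ {N : ℕ} (I : Instance N) where
  open Instance I

  module _ (t : ℚ) where

    mature-empty : ∀ {Z} → Empty Z → Mature I t Z
    mature-empty Z-empty = subst₂ _≤_
      (sym (sumIn-empty id ℓ Z-empty (allFin N)))
      (sym (sumIn-empty Request.node (λ ρ → Request.cost ρ t) Z-empty requests))
      ℚₚ.≤-refl

    mature-∪ : ∀ {P Q} → Disjoint P Q → Mature I t P → Mature I t Q → Mature I t (P ∪ Q)
    mature-∪ disj mP mQ = subst₂ _≤_
      (sym (sumIn-∪ id ℓ disj (allFin N)))
      (sym (sumIn-∪ Request.node (λ ρ → Request.cost ρ t) disj requests))
      (ℚₚ.+-mono-≤ mP mQ)

  Ancestor : Fin N → Fin N → Set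
  Ancestor a b = ∃ λ k → iter parent k b ≡ a

  ancestor-refl : ∀ {a} → Ancestor a a
  ancestor-refl = 0 , refl

  ancestor-parent : ∀ {a} → Ancestor (parent a) a
  ancestor-parent = 1 , refl

  ancestor-trans : ∀ {a b c} → Ancestor a b → Ancestor b c → Ancestor a c
  ancestor-trans {c = c} (k , e) (m , e') =
    k Nat.+ m , trans (iter-+ parent k m c) (trans (cong (iter parent k) e') e)

  ancestor-total : ∀ {a b c} → Ancestor a c → Ancestor b c → Ancestor a b ⊎ Ancestor b a
  ancestor-total {c = c} (k , refl) (m , refl) with ℕₚ.≤-total k m
  ... | inj₁ k≤m = inj₂ (m ∸ k , sym (iter-∸ parent c k≤m))
  ... | inj₂ m≤k = inj₁ (k ∸ m , sym (iter-∸ parent c m≤k))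

  ancestor-step : ∀ {a b} → Ancestor a b → a ≡ b ⊎ Ancestor a (parent b)
  ancestor-step         (zero  , e) = inj₁ (sym e)
  ancestor-step {b = b} (suc k , e) = inj₂ (k , trans (sym (iter-suc parent k b)) e)

  ancestor-of-root : ∀ {a} → Ancestor a root → a ≡ root
  ancestor-of-root (k , e) = trans (sym e) (iter-fixed parent parent-root k)

  isAnc⇒Ancestor : ∀ {a b} → T (isAnc I a b) → Ancestor a b
  isAnc⇒Ancestor isAnc-ab with satisfied (any⁻ _ (upTo (suc N)) isAnc-ab)
  ... | k , eq = k , toWitness eq

  Ancestor⇒isAnc : ∀ {a b} → Ancestor a b → T (isAnc I a b)
  Ancestor⇒isAnc {b = b} (k , e) with iter-bounded parent b k
  ... | j , j<1+N , e' = any⁺ _ (lose (∈-upTo⁺ j<1+N) (fromWitness (trans e' e)))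

  ∈-desc⁻ : ∀ {Z x v} → v ∈ desc I Z x → v ∈ Z × Ancestor x v
  ∈-desc⁻ v∈ with Equivalence.to T-∧ (∈-tabulate⁻ v∈)
  ... | v∈Z , x≼v = toWitness v∈Z , isAnc⇒Ancestor x≼v

  ∈-desc⁺ : ∀ {Z x v} → v ∈ Z → Ancestor x v → v ∈ desc I Z x
  ∈-desc⁺ v∈Z x≼v = ∈-tabulate⁺ (Equivalence.from T-∧ (fromWitness v∈Z , Ancestor⇒isAnc x≼v))

  desc-⊆ : ∀ {Z x} → desc I Z x ⊆ Z
  desc-⊆ = proj₁ ∘ ∈-desc⁻

  root∉desc : ∀ {Z x} → x ≢ root → root ∉ desc I Z x
  root∉desc x≢root = x≢root ∘ ancestor-of-root ∘ proj₂ ∘ ∈-desc⁻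

  desc-∪ : ∀ {X Y x} → desc I (X ∪ Y) x ≡ desc I X x ∪ (desc I Y x ─ X)
  desc-∪ {X} {Y} {x} = ⊆-antisym split join
    where
    split : desc I (X ∪ Y) x ⊆ desc I X x ∪ (desc I Y x ─ X)
    split {v} v∈ with ∈-desc⁻ v∈ | v ∈? X
    ... | _     , x≼v | yes v∈X = x∈p∪q⁺ (inj₁ (∈-desc⁺ v∈X x≼v))
    ... | v∈X∪Y , x≼v | no  v∉X =
      x∈p∪q⁺ (inj₂ (x∈p∧x∉q⇒x∈p─q (∈-desc⁺ v∈Y x≼v) v∉X))
      where
      v∈Y : v ∈ Y
      v∈Y = [ ⊥-elim ∘ v∉X , id ] (x∈p∪q⁻ X Y v∈X∪Y)
    join : desc I X x ∪ (desc I Y x ─ X) ⊆ desc I (X ∪ Y) x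
    join v∈ with x∈p∪q⁻ _ _ v∈
    ... | inj₁ v∈X_x with ∈-desc⁻ v∈X_x
    ...   | v∈X , x≼v = ∈-desc⁺ (x∈p∪q⁺ (inj₁ v∈X)) x≼v
    join v∈ | inj₂ v∈Y_x─X with ∈-desc⁻ (p─q⊆p _ X v∈Y_x─X)
    ...   | v∈Y , x≼v = ∈-desc⁺ (x∈p∪q⁺ (inj₂ v∈Y)) x≼v

  AncestorClosed : Subset N → Set
  AncestorClosed Z = ∀ {a b} → Ancestor a b → b ∈ Z → a ∈ Z

  DescendantClosedIn : Subset N → Subset N → Set
  DescendantClosedIn Y D = ∀ {a b} → a ∈ D → b ∈ Y → Ancestor a b → b ∈ D

  desc-descendantClosed : ∀ {Z x} → DescendantClosedIn Z (desc I Z x)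
  desc-descendantClosed a∈ b∈Z a≼b = ∈-desc⁺ b∈Z (ancestor-trans (proj₂ (∈-desc⁻ a∈)) a≼b)

  ─-descendantClosed : ∀ {X Y D} → AncestorClosed X → DescendantClosedIn Y D →
                       DescendantClosedIn Y (D ─ X)
  ─-descendantClosed {X} {D = D} closedX closedD a∈D─X b∈Y a≼b =
    x∈p∧x∉q⇒x∈p─q (closedD (p─q⊆p D X a∈D─X) b∈Y a≼b)
                  (x∈p─q⇒x∉q a∈D─X ∘ closedX a≼b)

  adj-sym : ∀ {u v} → Adj I u v → Adj I v u
  adj-sym = [ inj₂ , inj₁ ]

  path-source : ∀ {Z u v} → PathIn I Z u v → u ∈ Z
  path-source (here u∈Z)     = u∈Z
  path-source (step u∈Z _ _) = u∈Z

  path-mono : ∀ {Z Z' u v} → Z ⊆ Z' → PathIn I Z u v → PathIn I Z' u v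
  path-mono Z⊆Z' (here u∈Z)          = here (Z⊆Z' u∈Z)
  path-mono Z⊆Z' (step u∈Z adj path) = step (Z⊆Z' u∈Z) adj (path-mono Z⊆Z' path)

  path-++ : ∀ {Z u v w} → PathIn I Z u v → PathIn I Z v w → PathIn I Z u w
  path-++ (here _)            path' = path'
  path-++ (step u∈Z adj path) path' = step u∈Z adj (path-++ path path')

  path-reverse : ∀ {Z u v} → PathIn I Z u v → PathIn I Z v u
  path-reverse (here u∈Z)          = here u∈Z
  path-reverse (step u∈Z adj path) =
    path-++ (path-reverse path) (step (path-source path) (adj-sym adj) (here u∈Z))

  subtree-∪ : ∀ {X Y r} → IsSubtree I X → IsSubtree I Y → r ∈ X → r ∈ Y → IsSubtree I (X ∪ Y)
  subtree-∪ {X} {Y} {r} (_ , connX) (_ , connY) r∈X r∈Y =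
    (r , x∈p∪q⁺ (inj₁ r∈X)) ,
    λ u v u∈ v∈ → path-++ (toR u∈) (path-reverse (toR v∈))
    where
    toR : ∀ {u} → u ∈ X ∪ Y → PathIn I (X ∪ Y) u r
    toR {u} u∈ with x∈p∪q⁻ X Y u∈
    ... | inj₁ u∈X = path-mono (x∈p∪q⁺ ∘ inj₁) (connX u r u∈X r∈X)
    ... | inj₂ u∈Y = path-mono (x∈p∪q⁺ ∘ inj₂) (connY u r u∈Y r∈Y)

  -- A step down to a child w of u is absorbed by one more application of parent.
  path-to-root-ancestors : ∀ {Z u} → PathIn I Z u root → ∀ k → iter parent k u ∈ Z
  path-to-root-ancestors {Z} (here root∈Z) k =
    subst (_∈ Z) (sym (iter-fixed parent parent-root k)) root∈Z
  path-to-root-ancestors (step u∈Z _ _) zero = u∈Z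
  path-to-root-ancestors {Z} {u} (step _ (inj₁ (_ , refl)) path) (suc k) =
    subst (_∈ Z) (sym (iter-suc parent k u)) (path-to-root-ancestors path k)
  path-to-root-ancestors {Z} (step _ (inj₂ (_ , refl)) path) k =
    subst (_∈ Z) (iter-suc parent k _) (path-to-root-ancestors path (suc k))

  subtree⇒ancestorClosed : ∀ {Z} → IsSubtree I Z → root ∈ Z → AncestorClosed Z
  subtree⇒ancestorClosed {Z} (_ , conn) root∈Z {b = b} (k , refl) b∈Z =
    path-to-root-ancestors (conn b root b∈Z root∈Z) k

  depth-root : ∀ {k} → Depth I root k → k ≡ 0
  depth-root {zero}  _              = refl
  depth-root {suc k} (_ , notBefore) = ⊥-elim (notBefore 0 (s≤s z≤n) refl)

  isRootOf-root : ∀ {Z} → root ∈ Z → IsRootOf I Z root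
  isRootOf-root root∈Z = root∈Z , λ _ _ k' _ depth _ → subst (Nat._≤ k') (sym (depth-root depth)) z≤n

  isRootOf-unique : ∀ {Z z} → root ∈ Z → IsRootOf I Z z → z ≡ root
  isRootOf-unique {z = z} root∈Z (_ , closest)
    with minimal-witness (λ j → iter parent j z ≟ root) (reaches z)
  ... | m , depth-z with closest root m 0 root∈Z depth-z (refl , λ _ ())
  ... | z≤n = proj₁ depth-z

  covered⇒mature-desc : ∀ {t Z} → root ∈ Z → Covered I t Z →
                        ∀ {x} → x ∈ Z → x ≢ root → Mature I t (desc I Z x)
  covered⇒mature-desc root∈Z covered x∈Z x≢root = covered root (isRootOf-root root∈Z) _ x∈Z x≢root

  module _ (t : ℚ) {Y : Subset N} (closedY : AncestorClosed Y)
           (matureY : ∀ {y} → y ∈ Y → y ≢ root → Mature I t (desc I Y y)) where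

    private
      remainder-descendantClosed : ∀ {D y} → DescendantClosedIn Y D → parent y ∉ D →
                                   DescendantClosedIn Y (D ─ desc I Y y)
      remainder-descendantClosed {D} {y} closedD py∉D {a} {b} a∈D' b∈Y a≼b with b ∈? desc I Y y
      ... | no b∉Y_y = x∈p∧x∉q⇒x∈p─q (closedD (p─q⊆p D _ a∈D') b∈Y a≼b) b∉Y_y
      ... | yes b∈Y_y with ∈-desc⁻ b∈Y_y
      ... | _ , y≼b with ancestor-total a≼b y≼b
      ...   | inj₂ y≼a = ⊥-elim (x∈p─q⇒x∉q a∈D' (∈-desc⁺ (closedY a≼b b∈Y) y≼a))
      ...   | inj₁ a≼y with ancestor-step a≼y
      ...     | inj₁ refl = ⊥-elim (x∈p─q⇒x∉q a∈D' (∈-desc⁺ (closedY y≼b b∈Y) ancestor-refl))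
      ...     | inj₂ a≼py =
        ⊥-elim (py∉D (closedD (p─q⊆p D _ a∈D') (closedY ancestor-parent (closedY y≼b b∈Y)) a≼py))

      mature-by-size : ∀ {D} → Acc _<_ ∣ D ∣ → D ⊆ Y → root ∉ D →
                       DescendantClosedIn Y D → Mature I t D
      mature-by-size {D} (acc smaller) D⊆Y root∉D closedD with nonempty? D
      ... | no D-empty = mature-empty t D-empty
      ... | yes (v , v∈D) with reaches v
      ... | k , reach with iter-exit parent (_∈? D) k v∈D (root∉D ∘ subst (_∈ D) reach)
      ... | y , y∈D , py∉D =
        subst (Mature I t) (sym (⊆⇒≡∪─ Y_y⊆D))
              (mature-∪ t (disjoint-─ _ D) (matureY (D⊆Y y∈D) y≢root) rest)
        where
        y≢root : y ≢ root
        y≢root refl = root∉D y∈D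
        Y_y⊆D : desc I Y y ⊆ D
        Y_y⊆D v∈ with ∈-desc⁻ v∈
        ... | v∈Y , y≼v = closedD y∈D v∈Y y≼v
        rest : Mature I t (D ─ desc I Y y)
        rest = mature-by-size
          (smaller (p∩q≢∅⇒∣p─q∣<∣p∣ D _ (y , x∈p∩q⁺ (y∈D , ∈-desc⁺ (D⊆Y y∈D) ancestor-refl))))
          (D⊆Y ∘ p─q⊆p D _) (root∉D ∘ p─q⊆p D _) (remainder-descendantClosed closedD py∉D)

    mature-descendantClosed : ∀ {D} → D ⊆ Y → root ∉ D → DescendantClosedIn Y D → Mature I t D
    mature-descendantClosed = mature-by-size (<-wellFounded _)


  mature-desc-∪ : ∀ {t X Y x} → root ∈ X → AncestorClosed X → AncestorClosed Y →
                  (∀ {y} → y ∈ X → y ≢ root → Mature I t (desc I X y)) →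
                  (∀ {y} → y ∈ Y → y ≢ root → Mature I t (desc I Y y)) →
                  x ≢ root → Mature I t (desc I (X ∪ Y) x)
  mature-desc-∪ {t} {X} root∈X closedX closedY matureX matureY x≢root =
    subst (Mature I t) (sym desc-∪)
      (mature-∪ t (λ v∈X_x v∈Y_x─X → x∈p─q⇒x∉q v∈Y_x─X (desc-⊆ v∈X_x))
        (mature-descendantClosed t closedX matureX desc-⊆ (root∉desc x≢root) desc-descendantClosed)
        (mature-descendantClosed t closedY matureY (desc-⊆ ∘ p─q⊆p _ X)
          (λ root∈Y_x─X → x∈p─q⇒x∉q root∈Y_x─X root∈X)
          (─-descendantClosed closedX desc-descendantClosed)))

mainTheorem7 : ∀ {N : ℕ} (I : Instance N) (t : ℚ) → 0ℚ ≤ t →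
    ∀ (X Y : Subset N) →
    IsSubtree I X → Instance.root I ∈ X → Covered I t X →
    IsSubtree I Y → Instance.root I ∈ Y → Covered I t Y →
    IsSubtree I (X ∪ Y) × Instance.root I ∈ (X ∪ Y) × Covered I t (X ∪ Y)
mainTheorem7 I t _ X Y subX root∈X covX subY root∈Y covY =
  subtree-∪ I subX subY root∈X root∈Y , root∈X∪Y , covered
  where
  open Instance I using (root)
  root∈X∪Y : root ∈ X ∪ Y
  root∈X∪Y = x∈p∪q⁺ (inj₁ root∈X)
  covered : Covered I t (X ∪ Y)
  covered rZ isRoot x _ x≢rZ =
    mature-desc-∪ I root∈X
      (subtree⇒ancestorClosed I subX root∈X) (subtree⇒ancestorClosed I subY root∈Y)
      (covered⇒mature-desc I root∈X covX) (covered⇒mature-desc I root∈Y covY)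
      (subst (x ≢_) (isRootOf-unique I root∈X∪Y isRoot) x≢rZ)
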